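{- Let $A$ be a finite non-empty alphabet, let $\lambda$ be a left-infinite word over $A$ and $\rho$ a right-infinite word over $A$. The set $OG_{\lambda,\rho}=\{og(\lambda_n,\rho_n): n\in\mathbb{N}\}$ is finite if and only if $\lambda={}^{\omega}u\,w_1$ and $\rho=w_2\,u^{\omega}$ for some words $u\in A^+$ and $w_1,w_2\in A^*$.
   Context: $A^*$ is the free monoid (finite words, including the empty word) and $A^+$ the set of non-empty finite words over $A$; $\mathbb{N}=\{0,1,2,\dots\}$. A left-infinite word is a sequence $\cdots a_{ -2}a_{ -1}a_0$ of letters indexed by $-\mathbb{N}$; a right-infinite word is a sequence $a_0a_1a_2\cdots$ indexed by $\mathbb{N}$. For $u\in A^+$ and $w\in A^*$, ${}^{\omega}u\,w$ denotes the left-infinite word $\cdots uuuw$ and $w\,u^{\omega}$ the right-infinite word $wuuu\cdots$. For $n\in\mathbb{N}$, $\lambda_n$ is the suffix of length $n$ of $\lambda$ and $\rho_n$ is the prefix of length $n$ of $\rho$. For finite words $u,v$ of equal length: $log(u,v)=\min\{n\in\mathbb{N}: ux=x'v \text{ for some } x,x'\in A^n\}$, $rog(u,v)=\min\{n\in\mathbb{N}: xu=vx' \text{ for some } x,x'\in A^n\}$, and $og(u,v)=\min\{log(u,v),rog(u,v)\}$. -}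

module Defs where

open import Data.Nat using (ℕ; zero; suc; _<_; _⊓_)
open import Data.Nat.DivMod using (_mod_)
open import Data.List using (List; []; _∷_; _++_; length; map; upTo; reverse)
open import Data.Vec as Vec using (Vec)
open import Data.Product using (Σ; _×_; ∃-syntax)
open import Relation.Binary.PropositionalEquality using (_≡_)
open import Relation.Nullary using (¬_)

-- A left-infinite word  ⋯ a₋₂ a₋₁ a₀  is represented by  λ : ℕ → A  with  λ i = a₋ᵢ .
LeftWord : Set → Set
LeftWord A = ℕ → A

RightWord : Set → Set
RightWord A = ℕ → A

_≈ω_ : {A : Set} → (ℕ → A) → (ℕ → A) → Set
f ≈ω g = ∀ i → f i ≡ g i

prepend : {A : Set} → List A → (ℕ → A) → (ℕ → A)
prepend []       f i       = f i
prepend (a ∷ w)  f zero    = a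
prepend (a ∷ w)  f (suc i) = prepend w f i

cyc : {A : Set} {m : ℕ} → Vec A (suc m) → ℕ → A
cyc {m = m} u i = Vec.lookup u (i mod suc m)

rightPer : {A : Set} {m : ℕ} → List A → Vec A (suc m) → RightWord A
rightPer w u = prepend w (cyc u)

-- ^ω u w  (read from the right end: index i is the letter at position -i)
leftPer : {A : Set} {m : ℕ} → Vec A (suc m) → List A → LeftWord A
leftPer u w = prepend (reverse w) (cyc (Vec.reverse u))

suffix : {A : Set} → LeftWord A → ℕ → List A
suffix λ' n = reverse (map λ' (upTo n))

prefix : {A : Set} → RightWord A → ℕ → List A
prefix ρ n = map ρ (upTo n)

LogAdm : {A : Set} → List A → List A → ℕ → Set
LogAdm {A} u v n = ∃[ x ] ∃[ x' ] (length {A = A} x ≡ n × length {A = A} x' ≡ n × u ++ x ≡ x' ++ v)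

RogAdm : {A : Set} → List A → List A → ℕ → Set
RogAdm {A} u v n = ∃[ x ] ∃[ x' ] (length {A = A} x ≡ n × length {A = A} x' ≡ n × x ++ u ≡ v ++ x')

IsMin : (ℕ → Set) → ℕ → Set
IsMin P k = P k × (∀ j → j < k → ¬ P j)

IsLog : {A : Set} → List A → List A → ℕ → Set
IsLog u v = IsMin (LogAdm u v)

IsRog : {A : Set} → List A → List A → ℕ → Set
IsRog u v = IsMin (RogAdm u v)

IsOg : {A : Set} → List A → List A → ℕ → Set
IsOg u v k = ∃[ l ] ∃[ r ] (IsLog u v l × IsRog u v r × k ≡ l ⊓ r)

-- OG_{λ,ρ} = { og(λₙ,ρₙ) : n ∈ ℕ } is finite  (a subset of ℕ is finite iff bounded)
OGFinite : {A : Set} → LeftWord A → RightWord A → Set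
OGFinite λ' ρ = Σ ℕ λ B → ∀ n k → IsOg (suffix λ' n) (prefix ρ n) k → k Data.Nat.≤ B

-- Write λ(i) for the letter of λ at position −i and ρ(j) for the letter of ρ at position j.
--
-- If λ = ᵚu w₁ and ρ = w₂ uᵚ, then for long n the words λₙ and ρₙ admit a right overlap of
-- length at most |w₁| + |w₂| + |u|: past the prefixes w₁ and w₂ the two periodic tails mirror
-- each other modulo |u|.
--
-- Conversely, let og(λₙ, ρₙ) ≤ B for all n. A left overlap of length l ≤ B of λₙ and ρₙ says
-- λ(i) = ρ(j) whenever i + j + 1 = n − l, and a right overlap of length r ≤ B says the same for
-- i, j ≥ r and i + j + 1 = n + r. So every interval [n, n + 2B] contains an s at which λ and ρ
-- mirror each other beyond B. Comparing two such s < s′ ≤ s + 2B + 1 through the letters of λ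
-- shows that ρ (and likewise λ) is (s′ − s)-periodic on a long window; since s′ − s divides
-- (2B + 1)!, both words are (2B + 1)!-periodic from B on, and one more mirror point identifies
-- the period word of λ with the reverse of that of ρ.
module Submission where

open import Defs
open import Data.Nat using (ℕ; zero; suc; pred; _+_; _*_; _∸_; _≤_; _<_; _⊓_; _%_; _/_; _!; _≤?_; z≤n; s≤s)
open import Data.Nat.Properties
open import Data.Nat.DivMod using (_mod_; m≡m%n+[m/n]*n; m%n<n)
open import Data.Nat.Divisibility using (_∣_; m≤n⇒m!∣n!; ∣-trans; m∣m*n)
open import Data.Nat.Tactic.RingSolver using (solve-∀)
open import Data.Fin as Fin using (Fin; toℕ; fromℕ<)
open import Data.Fin.Properties using (toℕ-fromℕ<; inj⇒≟)
open import Data.List as List using (List; []; _∷_; _++_; length; map; upTo; applyUpTo; applyDownFrom)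
open import Data.List.Properties
  using (++-assoc; ∷-injective; ≡-dec; length-reverse; length-map; length-upTo; map-upTo; reverse-applyUpTo;
         reverse-involutive)
open import Data.Vec as Vec using (Vec; []; _∷_; _∷ʳ_; lookup; tabulate)
open import Data.Vec.Properties using (reverse-∷; lookup∘tabulate)
open import Data.Empty using (⊥-elim)
open import Data.Product using (Σ; _×_; _,_; proj₁; proj₂; map₁; ∃-syntax)
open import Data.Sum using (inj₁; inj₂)
open import Function using (_∘_)
open import Function.Bundles using (_↔_; _⇔_; mk⇔; Equivalence)
open import Function.Properties.Inverse using (↔⇒↣)
import Function.Properties.Equivalence as ⇔
open import Relation.Binary.Definitions using (DecidableEquality)
open import Relation.Binary.PropositionalEquality
open import Relation.Nullary using (¬_; Dec; yes; no)
import Relation.Nullary.Decidable as Dec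

shift : {A : Set} → ℕ → (ℕ → A) → ℕ → A
shift r f i = f (r + i)

IsMin-≤ : {P : ℕ → Set} {k n : ℕ} → IsMin P k → P n → k ≤ n
IsMin-≤ (_ , below) pn = ≮⇒≥ λ n<k → below _ n<k pn

least : (P : ℕ → Set) (n : ℕ) → (∀ j → j < n → Dec (P j)) → P n → Σ ℕ (IsMin P)
least P zero    P? pn = 0 , pn , λ _ ()
least P (suc n) P? pn with P? 0 (s≤s z≤n)
... | yes p0 = 0 , p0 , λ _ ()
... | no ¬p0 with least (P ∘ suc) n (λ j j<n → P? (suc j) (s≤s j<n)) pn
...   | k , pk , below = suc k , pk , below′
  where
  below′ : ∀ j → j < suc k → ¬ P j
  below′ zero    _         = ¬p0
  below′ (suc j) (s≤s j<k) = below j j<k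

module _ {A : Set} where

  ++-injective : ∀ (ws xs : List A) {ys zs} → length ws ≡ length xs →
                 ws ++ ys ≡ xs ++ zs → ws ≡ xs × ys ≡ zs
  ++-injective []       []       _   eq = refl , eq
  ++-injective (w ∷ ws) (x ∷ xs) len eq with ∷-injective eq
  ... | refl , eq′ = map₁ (cong (w ∷_)) (++-injective ws xs (suc-injective len) eq′)

  logAdm-length : ∀ {u v : List A} {n} → length u ≡ n → length v ≡ n → LogAdm u v n
  logAdm-length {u} {v} ∣u∣ ∣v∣ = v , u , ∣v∣ , ∣u∣ , refl

  rogAdm-length : ∀ {u v : List A} {n} → length u ≡ n → length v ≡ n → RogAdm u v n
  rogAdm-length {u} {v} ∣u∣ ∣v∣ = v , u , ∣v∣ , ∣u∣ , refl

  logAdm-++⇔ : ∀ {d} u₁ u₂ v₁ v₂ → length u₁ ≡ d → length v₂ ≡ d → length u₂ ≡ length v₁ →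
               LogAdm (u₁ ++ u₂) (v₁ ++ v₂) d ⇔ u₂ ≡ v₁
  logAdm-++⇔ u₁ u₂ v₁ v₂ ∣u₁∣ ∣v₂∣ ∣u₂∣≡∣v₁∣ = mk⇔ to from
    where
    to : LogAdm (u₁ ++ u₂) (v₁ ++ v₂) _ → u₂ ≡ v₁
    to (x , x′ , _ , ∣x′∣ , eq) =
      let u₂x≡v₁v₂ = proj₂ (++-injective u₁ x′ (trans ∣u₁∣ (sym ∣x′∣))
                                           (trans (sym (++-assoc u₁ u₂ x)) eq))
      in proj₁ (++-injective u₂ v₁ ∣u₂∣≡∣v₁∣ u₂x≡v₁v₂)
    from : u₂ ≡ v₁ → LogAdm (u₁ ++ u₂) (v₁ ++ v₂) _
    from refl = v₂ , u₁ , ∣v₂∣ , ∣u₁∣ , ++-assoc u₁ u₂ v₂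

  rogAdm-++⇔ : ∀ {d} u₁ u₂ v₁ v₂ → length u₂ ≡ d → length v₁ ≡ d → length u₁ ≡ length v₂ →
               RogAdm (u₁ ++ u₂) (v₁ ++ v₂) d ⇔ u₁ ≡ v₂
  rogAdm-++⇔ u₁ u₂ v₁ v₂ ∣u₂∣ ∣v₁∣ ∣u₁∣≡∣v₂∣ = mk⇔ to from
    where
    to : RogAdm (u₁ ++ u₂) (v₁ ++ v₂) _ → u₁ ≡ v₂
    to (x , x′ , ∣x∣ , _ , eq) =
      let u₁u₂≡v₂x′ = proj₂ (++-injective x v₁ (trans ∣x∣ (sym ∣v₁∣))
                                            (trans eq (++-assoc v₁ v₂ x′)))
      in proj₁ (++-injective u₁ v₂ ∣u₁∣≡∣v₂∣ u₁u₂≡v₂x′)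
    from : u₁ ≡ v₂ → RogAdm (u₁ ++ u₂) (v₁ ++ v₂) _
    from refl = v₁ , u₂ , ∣v₁∣ , ∣u₂∣ , sym (++-assoc v₁ u₁ u₂)

  applyUpTo-+ : ∀ (f : ℕ → A) m n → applyUpTo f (m + n) ≡ applyUpTo f m ++ applyUpTo (shift m f) n
  applyUpTo-+ f zero    n = refl
  applyUpTo-+ f (suc m) n = cong (f 0 ∷_) (applyUpTo-+ (f ∘ suc) m n)

  applyDownFrom-+ : ∀ (f : ℕ → A) m n → applyDownFrom f (m + n) ≡ applyDownFrom (shift n f) m ++ applyDownFrom f n
  applyDownFrom-+ f zero    n = refl
  applyDownFrom-+ f (suc m) n = cong₂ _∷_ (cong f (+-comm m n)) (applyDownFrom-+ f m n)

  suffix≡applyDownFrom : ∀ (λ' : LeftWord A) n → suffix λ' n ≡ applyDownFrom λ' n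
  suffix≡applyDownFrom λ' n = trans (cong List.reverse (map-upTo λ' n)) (reverse-applyUpTo λ' n)

  length-suffix : ∀ (λ' : LeftWord A) n → length (suffix λ' n) ≡ n
  length-suffix λ' n = trans (length-reverse (map λ' (upTo n))) (trans (length-map λ' (upTo n)) (length-upTo n))

  length-prefix : ∀ (ρ : RightWord A) n → length (prefix ρ n) ≡ n
  length-prefix ρ n = trans (length-map ρ (upTo n)) (length-upTo n)

  suffix-+ : ∀ (λ' : LeftWord A) m n → suffix λ' (m + n) ≡ suffix (shift n λ') m ++ suffix λ' n
  suffix-+ λ' m n = begin
    suffix λ' (m + n)                                  ≡⟨ suffix≡applyDownFrom λ' (m + n) ⟩
    applyDownFrom λ' (m + n)                           ≡⟨ applyDownFrom-+ λ' m n ⟩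
    applyDownFrom (shift n λ') m ++ applyDownFrom λ' n ≡⟨ cong₂ _++_ (suffix≡applyDownFrom (shift n λ') m)
                                                                     (suffix≡applyDownFrom λ' n) ⟨
    suffix (shift n λ') m ++ suffix λ' n               ∎
    where open ≡-Reasoning

  prefix-+ : ∀ (ρ : RightWord A) m n → prefix ρ (m + n) ≡ prefix ρ m ++ prefix (shift m ρ) n
  prefix-+ ρ m n = begin
    prefix ρ (m + n)                         ≡⟨ map-upTo ρ (m + n) ⟩
    applyUpTo ρ (m + n)                      ≡⟨ applyUpTo-+ ρ m n ⟩
    applyUpTo ρ m ++ applyUpTo (shift m ρ) n ≡⟨ cong₂ _++_ (map-upTo ρ m) (map-upTo (shift m ρ) n) ⟨
    prefix ρ m ++ prefix (shift m ρ) n       ∎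
    where open ≡-Reasoning

  Agree : LeftWord A → RightWord A → ℕ → Set
  Agree λ' ρ s = ∀ i j → suc (i + j) ≡ s → λ' i ≡ ρ j

  applyDownFrom≡applyUpTo⇔agree : ∀ (λ' : LeftWord A) ρ s → applyDownFrom λ' s ≡ applyUpTo ρ s ⇔ Agree λ' ρ s
  applyDownFrom≡applyUpTo⇔agree λ' ρ s = mk⇔ (to s ρ) (from s ρ)
    where
    to : ∀ s ρ → applyDownFrom λ' s ≡ applyUpTo ρ s → Agree λ' ρ s
    to (suc s) ρ eq i zero    i+0+1≡ =
      trans (cong λ' (trans (sym (+-identityʳ i)) (suc-injective i+0+1≡))) (proj₁ (∷-injective eq))
    to (suc s) ρ eq i (suc j) i+j+2≡ =
      to s (ρ ∘ suc) (proj₂ (∷-injective eq)) i j (trans (sym (+-suc i j)) (suc-injective i+j+2≡))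
    from : ∀ s ρ → Agree λ' ρ s → applyDownFrom λ' s ≡ applyUpTo ρ s
    from zero    ρ _     = refl
    from (suc s) ρ agree = cong₂ _∷_ (agree s 0 (cong suc (+-identityʳ s)))
      (from s (ρ ∘ suc) λ i j i+j+1≡ → agree i (suc j) (cong suc (trans (+-suc i j) i+j+1≡)))

  suffix≡prefix⇔agree : ∀ (λ' : LeftWord A) ρ s → suffix λ' s ≡ prefix ρ s ⇔ Agree λ' ρ s
  suffix≡prefix⇔agree λ' ρ s rewrite suffix≡applyDownFrom λ' s | map-upTo ρ s =
    applyDownFrom≡applyUpTo⇔agree λ' ρ s

  logAdm-suffix⇔ : ∀ (λ' : LeftWord A) ρ l m →
                   LogAdm (suffix λ' (l + m)) (prefix ρ (l + m)) l ⇔ suffix λ' m ≡ prefix ρ m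
  logAdm-suffix⇔ λ' ρ l m rewrite suffix-+ λ' l m | +-comm l m | prefix-+ ρ m l =
    logAdm-++⇔ (suffix (shift m λ') l) (suffix λ' m) (prefix ρ m) (prefix (shift m ρ) l)
               (length-suffix _ l) (length-prefix _ l) (trans (length-suffix λ' m) (sym (length-prefix ρ m)))

  rogAdm-suffix⇔ : ∀ (λ' : LeftWord A) ρ r m →
                   RogAdm (suffix λ' (m + r)) (prefix ρ (m + r)) r ⇔ suffix (shift r λ') m ≡ prefix (shift r ρ) m
  rogAdm-suffix⇔ λ' ρ r m rewrite suffix-+ λ' m r | +-comm m r | prefix-+ ρ r m =
    rogAdm-++⇔ (suffix (shift r λ') m) (suffix λ' r) (prefix ρ r) (prefix (shift r ρ) m)
               (length-suffix λ' r) (length-prefix ρ r) (trans (length-suffix _ m) (sym (length-prefix _ m)))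

  og-exists : DecidableEquality A → ∀ (λ' : LeftWord A) ρ n → Σ ℕ (IsOg (suffix λ' n) (prefix ρ n))
  og-exists _≟_ λ' ρ n
    with least (LogAdm u v) n log? (logAdm-length (length-suffix λ' n) (length-prefix ρ n))
       | least (RogAdm u v) n rog? (rogAdm-length (length-suffix λ' n) (length-prefix ρ n))
    where
    u = suffix λ' n
    v = prefix ρ n
    log? : ∀ j → j < n → Dec (LogAdm u v j)
    log? j j<n = subst (λ k → Dec (LogAdm (suffix λ' k) (prefix ρ k) j)) (m+[n∸m]≡n (<⇒≤ j<n))
                   (Dec.map (⇔.sym (logAdm-suffix⇔ λ' ρ j (n ∸ j))) (≡-dec _≟_ _ _))
    rog? : ∀ j → j < n → Dec (RogAdm u v j)
    rog? j j<n = subst (λ k → Dec (RogAdm (suffix λ' k) (prefix ρ k) j)) (m∸n+n≡m (<⇒≤ j<n))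
                   (Dec.map (⇔.sym (rogAdm-suffix⇔ λ' ρ j (n ∸ j))) (≡-dec _≟_ _ _))
  ... | l , isLog | r , isRog = l ⊓ r , l , r , isLog , isRog , refl

multiple-between : ∀ k n → 0 < k * n → k * n < n + n → k * n ≡ n
multiple-between 1             n _ _        = +-identityʳ n
multiple-between (suc (suc k)) n _ 2n>[2+k]n = ⊥-elim (<⇒≱ 2n>[2+k]n (+-monoʳ-≤ n (m≤m+n n (k * n))))

-- suc (a % suc m + b % suc m) is a positive multiple of suc m below 2 * suc m
suc[%+%]≡ : ∀ a b q m → suc (a + b) ≡ q * suc m → suc (a % suc m + b % suc m) ≡ suc m
suc[%+%]≡ a b q m eq = trans multiple (multiple-between (q ∸ Y) M (subst (0 <_) multiple (s≤s z≤n))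
                                                         (subst (_< M + M) multiple bound))
  where
  M = suc m
  x = a % M + b % M
  Y = a / M + b / M
  regroup : ∀ r s k l n → suc ((r + k * n) + (s + l * n)) ≡ suc (r + s) + (k + l) * n
  regroup = solve-∀
  divided : suc (a + b) ≡ suc x + Y * M
  divided = trans (cong₂ (λ a b → suc (a + b)) (m≡m%n+[m/n]*n a M) (m≡m%n+[m/n]*n b M))
                  (regroup (a % M) (b % M) (a / M) (b / M) M)
  multiple : suc x ≡ (q ∸ Y) * M
  multiple = begin
    suc x                  ≡⟨ m+n∸n≡m (suc x) (Y * M) ⟨
    suc x + Y * M ∸ Y * M  ≡⟨ cong (_∸ Y * M) (trans (sym divided) eq) ⟩
    q * M ∸ Y * M          ≡⟨ *-distribʳ-∸ M q Y ⟨
    (q ∸ Y) * M            ∎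
    where open ≡-Reasoning
  bound : suc x < M + M
  bound = s≤s (subst (suc x ≤_) (sym (+-suc m m))
                (s≤s (+-mono-≤ (≤-pred (m%n<n a M)) (≤-pred (m%n<n b M)))))

toℕ-mod : ∀ a m → toℕ (a mod suc m) ≡ a % suc m
toℕ-mod a m = toℕ-fromℕ< (m%n<n a (suc m))

module _ {A : Set} where

  lookup-∷ʳ-last : ∀ {n} (ys : Vec A n) x (i : Fin (suc n)) → toℕ i ≡ n → lookup (ys ∷ʳ x) i ≡ x
  lookup-∷ʳ-last []       x Fin.zero    _  = refl
  lookup-∷ʳ-last (y ∷ ys) x (Fin.suc i) eq = lookup-∷ʳ-last ys x i (suc-injective eq)

  lookup-∷ʳ-init : ∀ {n} (ys : Vec A n) x (i : Fin (suc n)) (j : Fin n) → toℕ i ≡ toℕ j →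
                   lookup (ys ∷ʳ x) i ≡ lookup ys j
  lookup-∷ʳ-init (y ∷ ys) x Fin.zero    Fin.zero    _  = refl
  lookup-∷ʳ-init (y ∷ ys) x (Fin.suc i) (Fin.suc j) eq = lookup-∷ʳ-init ys x i j (suc-injective eq)

  lookup-reverse : ∀ {n} (xs : Vec A n) (i j : Fin n) → suc (toℕ i + toℕ j) ≡ n →
                   lookup (Vec.reverse xs) i ≡ lookup xs j
  lookup-reverse (x ∷ xs) i Fin.zero eq rewrite reverse-∷ x xs =
    lookup-∷ʳ-last (Vec.reverse xs) x i (trans (sym (+-identityʳ (toℕ i))) (suc-injective eq))
  lookup-reverse {suc n} (x ∷ xs) i (Fin.suc j) eq rewrite reverse-∷ x xs =
    trans (lookup-∷ʳ-init (Vec.reverse xs) x i (fromℕ< i<n) (sym (toℕ-fromℕ< i<n)))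
          (lookup-reverse xs (fromℕ< i<n) j (trans (cong (λ t → suc (t + toℕ j)) (toℕ-fromℕ< i<n)) i+j+1≡n))
    where
    i+j+1≡n : suc (toℕ i + toℕ j) ≡ n
    i+j+1≡n = trans (sym (+-suc (toℕ i) (toℕ j))) (suc-injective eq)
    i<n : toℕ i < n
    i<n = subst (toℕ i <_) i+j+1≡n (s≤s (m≤m+n (toℕ i) (toℕ j)))

  cyc-reverse : ∀ {m} (u : Vec A (suc m)) a b q → suc (a + b) ≡ q * suc m → cyc (Vec.reverse u) a ≡ cyc u b
  cyc-reverse {m} u a b q eq = lookup-reverse u (a mod suc m) (b mod suc m)
    (trans (cong₂ (λ x y → suc (x + y)) (toℕ-mod a m) (toℕ-mod b m)) (suc[%+%]≡ a b q m eq))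

  period-iterate : ∀ {f : ℕ → A} {B p T} → (∀ x → B ≤ x → x + B < T → f (x + p) ≡ f x) →
                   ∀ q x → B ≤ x → x + q * p + B < T → f (x + q * p) ≡ f x
  period-iterate {f} per zero    x _   _ = cong f (+-identityʳ x)
  period-iterate {f} {B} {p} {T} per (suc q) x B≤x x+[1+q]p+B<T = begin
    f (x + (p + q * p))  ≡⟨ cong f (+-assoc x p (q * p)) ⟨
    f (x + p + q * p)    ≡⟨ period-iterate per q (x + p) (≤-trans B≤x (m≤m+n x p))
                              (subst (λ y → y + B < T) (sym (+-assoc x p (q * p))) x+[1+q]p+B<T) ⟩
    f (x + p)            ≡⟨ per x B≤x (≤-<-trans (+-monoˡ-≤ B (m≤m+n x (p + q * p))) x+[1+q]p+B<T) ⟩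
    f x                  ∎
    where open ≡-Reasoning

  eventually-periodic-% : ∀ {f : ℕ → A} {B m} → (∀ x → B ≤ x → f (x + suc m) ≡ f x) →
                          ∀ x t → B ≤ x → f (x + t) ≡ f (x + t % suc m)
  eventually-periodic-% {f} {B} {m} per x t B≤x = begin
    f (x + t)                    ≡⟨ cong (λ t → f (x + t)) (m≡m%n+[m/n]*n t M) ⟩
    f (x + (t % M + t / M * M))  ≡⟨ cong f (+-assoc x (t % M) (t / M * M)) ⟨
    f (x + t % M + t / M * M)    ≡⟨ period-iterate (λ y B≤y _ → per y B≤y) (t / M) (x + t % M)
                                      (≤-trans B≤x (m≤m+n x (t % M))) (n<1+n _) ⟩
    f (x + t % M)                ∎
    where
    M = suc m
    open ≡-Reasoning

  prepend-+ : ∀ (w : List A) f t → prepend w f (length w + t) ≡ f t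
  prepend-+ []      f t = refl
  prepend-+ (a ∷ w) f t = prepend-+ w f t

  ≈ω-prepend : ∀ (f g : ℕ → A) n → (∀ t → f (n + t) ≡ g t) → f ≈ω prepend (applyUpTo f n) g
  ≈ω-prepend f g zero    tail i       = tail i
  ≈ω-prepend f g (suc n) tail zero    = refl
  ≈ω-prepend f g (suc n) tail (suc i) = ≈ω-prepend (f ∘ suc) g n tail i

  CommonPeriodic : LeftWord A → RightWord A → Set
  CommonPeriodic λ' ρ =
    ∃[ m ] Σ (Vec A (suc m)) λ u → ∃[ w₁ ] ∃[ w₂ ] (λ' ≈ω leftPer u w₁ × ρ ≈ω rightPer w₂ u)

  CommonPeriodic⇒OGFinite : ∀ {λ' : LeftWord A} {ρ} → CommonPeriodic λ' ρ → OGFinite λ' ρ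
  CommonPeriodic⇒OGFinite {λ'} {ρ} (m , u , w₁ , w₂ , λ≈ , ρ≈) = W₁ + W₂ + M , og-bounded
    where
    M  = suc m
    W₁ = length w₁
    W₂ = length w₂

    λ-tail : ∀ a → λ' (W₁ + a) ≡ cyc (Vec.reverse u) a
    λ-tail a = trans (λ≈ (W₁ + a))
      (subst (λ k → prepend (List.reverse w₁) (cyc (Vec.reverse u)) (k + a) ≡ cyc (Vec.reverse u) a)
             (length-reverse w₁) (prepend-+ (List.reverse w₁) (cyc (Vec.reverse u)) a))

    ρ-tail : ∀ b → ρ (W₂ + b) ≡ cyc u b
    ρ-tail b = trans (ρ≈ (W₂ + b)) (prepend-+ w₂ (cyc u) b)

    rog-bounded : ∀ n → Σ ℕ λ d → d ≤ W₁ + W₂ + M × RogAdm (suffix λ' n) (prefix ρ n) d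
    rog-bounded n with n ≤? W₁ + W₂ + M
    ... | yes n≤ = n , n≤ , rogAdm-length (length-suffix λ' n) (length-prefix ρ n)
    ... | no  n≰ = d , d≤ , subst (λ k → RogAdm (suffix λ' k) (prefix ρ k) d) c+d≡n
                              (Equivalence.from (rogAdm-suffix⇔ λ' ρ d c)
                                (Equivalence.from (suffix≡prefix⇔agree _ _ c) agree))
      where
      -- e pads n to a multiple of M, which is what makes the two tails mirror each other past d
      e = M ∸ n % M
      d = W₁ + W₂ + e
      c = n ∸ d
      d≤ : d ≤ W₁ + W₂ + M
      d≤ = +-monoʳ-≤ (W₁ + W₂) (m∸n≤m M (n % M))
      c+d≡n : c + d ≡ n
      c+d≡n = m∸n+n≡m (≤-trans d≤ (<⇒≤ (≰⇒> n≰)))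
      n+e≡ : n + e ≡ suc (n / M) * M
      n+e≡ = begin
        n + e                    ≡⟨ cong (_+ e) (m≡m%n+[m/n]*n n M) ⟩
        n % M + n / M * M + e    ≡⟨ +-comm (n % M + n / M * M) e ⟩
        e + (n % M + n / M * M)  ≡⟨ +-assoc e (n % M) (n / M * M) ⟨
        e + n % M + n / M * M    ≡⟨ cong (_+ n / M * M) (m∸n+n≡m (<⇒≤ (m%n<n n M))) ⟩
        M + n / M * M            ∎
        where open ≡-Reasoning
      regroup : ∀ x y z i j → suc ((y + z + i) + (x + z + j)) ≡ suc (i + j) + (x + y + z) + z
      regroup = solve-∀
      λ-shift : ∀ x y z i → x + y + z + i ≡ x + (y + z + i)
      λ-shift = solve-∀
      ρ-shift : ∀ x y z j → x + y + z + j ≡ y + (x + z + j)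
      ρ-shift = solve-∀
      agree : Agree (shift d λ') (shift d ρ) c
      agree i j i+j+1≡c = begin
        λ' (d + i)                        ≡⟨ cong λ' (λ-shift W₁ W₂ e i) ⟩
        λ' (W₁ + (W₂ + e + i))            ≡⟨ λ-tail (W₂ + e + i) ⟩
        cyc (Vec.reverse u) (W₂ + e + i)  ≡⟨ cyc-reverse u (W₂ + e + i) (W₁ + e + j) (suc (n / M)) mirrored ⟩
        cyc u (W₁ + e + j)                ≡⟨ ρ-tail (W₁ + e + j) ⟨
        ρ (W₂ + (W₁ + e + j))             ≡⟨ cong ρ (ρ-shift W₁ W₂ e j) ⟨
        ρ (d + j)                         ∎
        where
        open ≡-Reasoning
        mirrored : suc ((W₂ + e + i) + (W₁ + e + j)) ≡ suc (n / M) * M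
        mirrored = trans (regroup W₁ W₂ e i j)
                         (trans (cong (λ k → k + d + e) i+j+1≡c) (trans (cong (_+ e) c+d≡n) n+e≡))

    og-bounded : ∀ n k → IsOg (suffix λ' n) (prefix ρ n) k → k ≤ W₁ + W₂ + M
    og-bounded n k (l , r , _ , isRog , k≡l⊓r) with rog-bounded n
    ... | d , d≤ , adm =
      subst (_≤ W₁ + W₂ + M) (sym k≡l⊓r) (≤-trans (m⊓n≤n l r) (≤-trans (IsMin-≤ isRog adm) d≤))

  AgreeBeyond : ℕ → LeftWord A → RightWord A → ℕ → Set
  AgreeBeyond B λ' ρ s = ∀ i j → B ≤ i → B ≤ j → suc (i + j) ≡ s → λ' i ≡ ρ j

  agree-shift : ∀ {λ' : LeftWord A} {ρ} r c → Agree (shift r λ') (shift r ρ) c → AgreeBeyond r λ' ρ (c + r + r)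
  agree-shift r c agree i j r≤i r≤j i+j+1≡ with m≤n⇒∃[o]m+o≡n r≤i | m≤n⇒∃[o]m+o≡n r≤j
  ... | i′ , refl | j′ , refl =
    agree i′ j′ (+-cancelʳ-≡ r _ c (+-cancelʳ-≡ r _ (c + r) (trans (sym (regroup r i′ j′)) i+j+1≡)))
    where
    regroup : ∀ r i j → suc ((r + i) + (r + j)) ≡ suc (i + j) + r + r
    regroup = solve-∀

  log-agree : ∀ {λ' : LeftWord A} {ρ n l} → IsLog (suffix λ' n) (prefix ρ n) l → Agree λ' ρ (n ∸ l)
  log-agree {λ'} {ρ} {n} {l} isLog =
    Equivalence.to (suffix≡prefix⇔agree λ' ρ (n ∸ l)) (Equivalence.to (logAdm-suffix⇔ λ' ρ l (n ∸ l))
      (subst (λ k → LogAdm (suffix λ' k) (prefix ρ k) l) (sym (m+[n∸m]≡n l≤n)) (proj₁ isLog)))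
    where
    l≤n : l ≤ n
    l≤n = IsMin-≤ isLog (logAdm-length (length-suffix λ' n) (length-prefix ρ n))

  rog-agree : ∀ {λ' : LeftWord A} {ρ n r} → IsRog (suffix λ' n) (prefix ρ n) r → AgreeBeyond r λ' ρ (n + r)
  rog-agree {λ'} {ρ} {n} {r} isRog =
    subst (λ k → AgreeBeyond r λ' ρ (k + r)) (m∸n+n≡m r≤n) (agree-shift r (n ∸ r)
      (Equivalence.to (suffix≡prefix⇔agree _ _ (n ∸ r)) (Equivalence.to (rogAdm-suffix⇔ λ' ρ r (n ∸ r))
        (subst (λ k → RogAdm (suffix λ' k) (prefix ρ k) r) (sym (m∸n+n≡m r≤n)) (proj₁ isRog)))))
    where
    r≤n : r ≤ n
    r≤n = IsMin-≤ isRog (rogAdm-length (length-suffix λ' n) (length-prefix ρ n))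

  agree-period : ∀ {λ' : LeftWord A} {ρ B s} p → AgreeBeyond B λ' ρ s → AgreeBeyond B λ' ρ (s + p) →
                 ∀ x → B ≤ x → x + B < s → ρ (x + p) ≡ ρ x × λ' (x + p) ≡ λ' x
  agree-period {B = B} {s} p agree agree′ x B≤x x+B<s with m≤n⇒∃[o]m+o≡n x+B<s
  ... | o , x+B+o+1≡s = trans (sym (agree′ i (x + p) B≤i B≤x+p i+x+p+1≡)) (agree i x B≤i B≤x i+x+1≡)
                      , trans (agree′ (x + p) i B≤x+p B≤i x+p+i+1≡) (sym (agree x i B≤x B≤i x+i+1≡))
    where
    i = B + o
    B≤i = m≤m+n B o
    B≤x+p = ≤-trans B≤x (m≤m+n x p)
    regroup : ∀ x B o p → suc (x + (B + o)) + p ≡ suc ((x + p) + (B + o))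
    regroup = solve-∀
    x+i+1≡ : suc (x + i) ≡ s
    x+i+1≡ = trans (cong suc (sym (+-assoc x B o))) x+B+o+1≡s
    i+x+1≡ : suc (i + x) ≡ s
    i+x+1≡ = trans (cong suc (+-comm i x)) x+i+1≡
    x+p+i+1≡ : suc ((x + p) + i) ≡ s + p
    x+p+i+1≡ = trans (sym (regroup x B o p)) (cong (_+ p) x+i+1≡)
    i+x+p+1≡ : suc (i + (x + p)) ≡ s + p
    i+x+p+1≡ = trans (cong suc (+-comm i (x + p))) x+p+i+1≡

  periodic-agree⇒CommonPeriodic : ∀ {λ' : LeftWord A} {ρ B m C} →
    (∀ x → B ≤ x → λ' (x + suc m) ≡ λ' x) → (∀ x → B ≤ x → ρ (x + suc m) ≡ ρ x) →
    B ≤ C → AgreeBeyond B λ' ρ (C + (B + suc m)) → CommonPeriodic λ' ρ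
  periodic-agree⇒CommonPeriodic {λ'} {ρ} {B} {m} {C} λ-per ρ-per B≤C agree =
    m , u , List.reverse (applyUpTo λ' C) , applyUpTo ρ B , λ≈ , ≈ω-prepend ρ (cyc u) B ρ-tail
    where
    M = suc m
    u = tabulate (λ t → ρ (B + toℕ t))

    ρ-tail : ∀ t → ρ (B + t) ≡ cyc u t
    ρ-tail t = begin
      ρ (B + t)              ≡⟨ eventually-periodic-% ρ-per B t ≤-refl ⟩
      ρ (B + t % M)          ≡⟨ cong (λ k → ρ (B + k)) (toℕ-mod t m) ⟨
      ρ (B + toℕ (t mod M))  ≡⟨ lookup∘tabulate (λ i → ρ (B + toℕ i)) (t mod M) ⟨
      cyc u t                ∎
      where open ≡-Reasoning

    λ-tail : ∀ t → λ' (C + t) ≡ cyc (Vec.reverse u) t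
    λ-tail t = begin
      λ' (C + t)             ≡⟨ eventually-periodic-% λ-per C t B≤C ⟩
      λ' (C + t % M)         ≡⟨ agree (C + t % M) (B + b) (≤-trans B≤C (m≤m+n C (t % M))) (m≤m+n B b) mirrored ⟩
      ρ (B + b)              ≡⟨ ρ-tail b ⟩
      cyc u b                ≡⟨ cyc-reverse u t b (suc (t / M)) t+b+1≡ ⟨
      cyc (Vec.reverse u) t  ∎
      where
      open ≡-Reasoning
      b = m ∸ t % M
      t%M+b≡m : t % M + b ≡ m
      t%M+b≡m = m+[n∸m]≡n (≤-pred (m%n<n t M))
      regroup₁ : ∀ c x B y → suc ((c + x) + (B + y)) ≡ c + (B + suc (x + y))
      regroup₁ = solve-∀
      regroup₂ : ∀ x z y → suc ((x + z) + y) ≡ suc (x + y) + z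
      regroup₂ = solve-∀
      mirrored : suc ((C + t % M) + (B + b)) ≡ C + (B + M)
      mirrored = trans (regroup₁ C (t % M) B b) (cong (λ k → C + (B + suc k)) t%M+b≡m)
      t+b+1≡ : suc (t + b) ≡ suc (t / M) * M
      t+b+1≡ = trans (cong (λ k → suc (k + b)) (m≡m%n+[m/n]*n t M))
                     (trans (regroup₂ (t % M) (t / M * M) b) (cong (λ k → suc k + t / M * M) t%M+b≡m))

    λ≈ : λ' ≈ω leftPer u (List.reverse (applyUpTo λ' C))
    λ≈ i = trans (≈ω-prepend λ' (cyc (Vec.reverse u)) C λ-tail i)
                 (cong (λ w → prepend w (cyc (Vec.reverse u)) i) (sym (reverse-involutive (applyUpTo λ' C))))

∣n! : ∀ {p n} → 0 < p → p ≤ n → p ∣ n !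
∣n! {suc p} _ p≤n = ∣-trans (m∣m*n (p !)) (m≤n⇒m!∣n! p≤n)

module _ {A : Set} (_≟_ : DecidableEquality A) (λ' : LeftWord A) (ρ : RightWord A) (B : ℕ)
         (og≤B : ∀ n k → IsOg (suffix λ' n) (prefix ρ n) k → k ≤ B) where

  agree-near : ∀ n → Σ ℕ λ s → AgreeBeyond B λ' ρ s × n ≤ s + B × s ≤ n + B
  agree-near n with og-exists _≟_ λ' ρ n
  ... | k , og@(l , r , isLog , isRog , k≡l⊓r) with ⊓-sel l r
  ...   | inj₁ l⊓r≡l = n ∸ l , (λ i j _ _ → log-agree isLog i j)
                     , subst (n ≤_) (+-comm B (n ∸ l)) (≤-trans (m≤n+m∸n n l) (+-monoˡ-≤ (n ∸ l) l≤B))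
                     , ≤-trans (m∸n≤m n l) (m≤m+n n B)
    where
    l≤B : l ≤ B
    l≤B = subst (_≤ B) (trans k≡l⊓r l⊓r≡l) (og≤B n k og)
  ...   | inj₂ l⊓r≡r = n + r , (λ i j B≤i B≤j → rog-agree isRog i j (≤-trans r≤B B≤i) (≤-trans r≤B B≤j))
                     , ≤-trans (m≤m+n n r) (m≤m+n (n + r) B)
                     , +-monoʳ-≤ n r≤B
    where
    r≤B : r ≤ B
    r≤B = subst (_≤ B) (trans k≡l⊓r l⊓r≡r) (og≤B n k og)

  agree-after : ∀ n → Σ ℕ λ s → AgreeBeyond B λ' ρ s × n ≤ s × s ≤ n + (B + B)
  agree-after n with agree-near (n + B)
  ... | s , agree , n+B≤s+B , s≤n+B+B = s , agree , +-cancelʳ-≤ B n s n+B≤s+B , subst (s ≤_) (+-assoc n B B) s≤n+B+B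

  N : ℕ
  N = suc (B + B) !

  eventually-periodic : ∀ x → B ≤ x → ρ (x + N) ≡ ρ x × λ' (x + N) ≡ λ' x
  eventually-periodic x B≤x with agree-after (suc (x + N + B))
  ... | s , agree , x+N+B<s , _ with agree-after (suc s)
  ...   | s′ , agree′ , s<s′ , s′≤ = iterate ρ (λ y B≤y y+B<s → proj₁ (local y B≤y y+B<s))
                                   , iterate λ' (λ y B≤y y+B<s → proj₂ (local y B≤y y+B<s))
    where
    p = s′ ∸ s
    s+p≡s′ : s + p ≡ s′
    s+p≡s′ = m+[n∸m]≡n (<⇒≤ s<s′)
    p∣N : p ∣ N
    p∣N = ∣n! (m<n⇒0<n∸m s<s′) (m≤n+o⇒m∸n≤o s′ s (subst (s′ ≤_) (sym (+-suc s (B + B))) s′≤))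
    open _∣_ p∣N renaming (quotient to q; equality to N≡q*p)
    local = agree-period p agree (subst (AgreeBeyond B λ' ρ) (sym s+p≡s′) agree′)
    iterate : (f : ℕ → A) → (∀ y → B ≤ y → y + B < s → f (y + p) ≡ f y) → f (x + N) ≡ f x
    iterate f per = subst (λ k → f (x + k) ≡ f x) (sym N≡q*p)
                      (period-iterate per q x B≤x (subst (λ k → x + k + B < s) N≡q*p x+N+B<s))

  OGFinite⇒CommonPeriodic : CommonPeriodic λ' ρ
  OGFinite⇒CommonPeriodic with agree-after (B + (B + suc (pred N)))
  ... | s , agree , B+[B+M]≤s , _ =
    periodic-agree⇒CommonPeriodic (λ x B≤x → subst (λ k → λ' (x + k) ≡ λ' x) N≡M (proj₂ (eventually-periodic x B≤x)))
                            (λ x B≤x → subst (λ k → ρ (x + k) ≡ ρ x) N≡M (proj₁ (eventually-periodic x B≤x)))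
                            B≤C (subst (AgreeBeyond B λ' ρ) (sym C+[B+M]≡s) agree)
    where
    M = suc (pred N)
    N≡M : N ≡ M
    N≡M = sym (suc-pred N {{suc (B + B) !≢0}})
    C = s ∸ (B + M)
    B≤C : B ≤ C
    B≤C = subst (_≤ C) (m+n∸n≡m B (B + M)) (∸-monoˡ-≤ (B + M) B+[B+M]≤s)
    C+[B+M]≡s : C + (B + M) ≡ s
    C+[B+M]≡s = m∸n+n≡m (m+n≤o⇒n≤o B B+[B+M]≤s)

theorem3p6 : (A : Set) (k : ℕ) → A ↔ Fin (suc k) →
    (λ' : LeftWord A) (ρ : RightWord A) →
    OGFinite λ' ρ ⇔
      (∃[ m ] Σ (Vec A (suc m)) λ u → ∃[ w₁ ] ∃[ w₂ ]
         (λ' ≈ω leftPer u w₁ × ρ ≈ω rightPer w₂ u))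
theorem3p6 A k A↔Fin λ' ρ =
  mk⇔ (λ (B , og≤B) → OGFinite⇒CommonPeriodic (inj⇒≟ (↔⇒↣ A↔Fin)) λ' ρ B og≤B) CommonPeriodic⇒OGFinite
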